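{- Let $n\ge 1$ and suppose $\mathcal{O}$ is a perfect odd cover of the complete graph $K_{2n}$. If $I$ is a nonempty subset of $V(K_{2n})$, then there is a biclique $(X,Y)\in\mathcal{O}$ such that $|X\cap I|$ is odd or $|Y\cap I|$ is odd.
   Context: An odd cover of a graph $G$ is a collection of complete bipartite graphs (bicliques) with disjoint parts $(X,Y)$, $X,Y\subseteq V(G)$, such that each edge of $G$ is covered (one endpoint in $X$, the other in $Y$) by an odd number of them and each nonedge by an even number. A perfect odd cover is an odd cover of cardinality $r_2(G)/2$, where $r_2(G)$ is the rank over $\mathbb{F}_2$ of the adjacency matrix of $G$ (for $K_{2n}$ this is $2n$, so a perfect odd cover has $n$ bicliques). -}

module Defs where

open import Data.Nat using (ℕ; suc; _+_; _%_)
open import Data.Fin using (Fin)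
open import Data.Fin.Subset using (Subset; _∈_; _∩_; ∣_∣; Nonempty; Empty)
open import Data.Fin.Subset.Properties using (_∈?_)
open import Data.Product using (Σ; _×_; _,_; ∃)
open import Data.Sum using (_⊎_)
open import Data.Vec using (Vec; tabulate; countᵇ)
open import Data.Bool using (Bool; _∧_; _∨_)
open import Relation.Nullary using (¬_; does)
open import Relation.Binary.PropositionalEquality using (_≡_; _≢_)

Odd : ℕ → Set
Odd k = k % 2 ≡ 1

Even : ℕ → Set
Even k = k % 2 ≡ 0

record Biclique (V : ℕ) : Set where
  constructor biclique
  field
    X : Subset V
    Y : Subset V
    disjoint : Empty (X ∩ Y)
open Biclique public

covers : {V : ℕ} → Biclique V → Fin V → Fin V → Bool
covers B u v = (does (u ∈? X B) ∧ does (v ∈? Y B)) ∨ (does (v ∈? X B) ∧ does (u ∈? Y B))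

Collection : ℕ → ℕ → Set
Collection V k = Vec (Biclique V) k

coverCount : {V k : ℕ} → Collection V k → Fin V → Fin V → ℕ
coverCount 𝒪 u v = countᵇ (λ B → covers B u v) 𝒪

-- A graph on vertex set Fin V given by its (symmetric, irreflexive) adjacency relation.
IsOddCover : {V k : ℕ} → (Fin V → Fin V → Set) → Collection V k → Set
IsOddCover {V} E 𝒪 =
  (u v : Fin V) → u ≢ v →
    (E u v → Odd (coverCount 𝒪 u v)) × (¬ E u v → Even (coverCount 𝒪 u v))

Complete : {V : ℕ} → Fin V → Fin V → Set
Complete u v = u ≢ v

-- r₂(K_{2n}) = 2n, so a perfect odd cover of K_{2n} is an odd cover with n bicliques.
PerfectOddCoverK : (n : ℕ) → Collection (n + n) n → Set
PerfectOddCoverK n 𝒪 = IsOddCover Complete 𝒪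

{-# OPTIONS --safe #-}
module Submission where

-- Over 𝔽₂ the cover matrix M(u,v) = #{B covering uv} is Σ_B (x_B y_Bᵀ + y_B x_Bᵀ), so
-- M 1_I = Σ_B (|X_B ∩ I| y_B + |Y_B ∩ I| x_B), which vanishes if every biclique meets I
-- evenly.  For an odd cover of K_m we have M = J + Id, so M 1_I = |I| 1 + 1_I: the
-- indicator of I is then constant, and summing it gives |I| = m |I| = 0 when m is even,
-- so I = ∅.  Neither n ≥ 1 nor the number of bicliques matters, only that m is even.

open import Defs
open import Data.Nat using (ℕ; _+_; _≥_)
open import Data.Fin using (Fin)
open import Data.Fin.Subset using (Subset; _∩_; ∣_∣; Nonempty)
open import Data.Vec using (Vec)
open import Data.Vec.Membership.Propositional using (_∈_)
open import Data.Product using (Σ; _×_)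
open import Data.Sum using (_⊎_)

open import Algebra.Bundles using (CommutativeRing)
import Algebra.Properties.CommutativeSemigroup as CommutativeSemigroupProperties
import Algebra.Properties.Group as GroupProperties
open import Data.Bool using (Bool; true; false; not; _∧_; _∨_; _xor_)
open import Data.Bool.Properties
  using ( xor-∧-commutativeRing; xor-is-ok; xor-same; not-distribˡ-xor; not-involutive
        ; xor-identityʳ; ¬-not; ∧-comm; ∧-identityʳ; ∧-distribʳ-xor)
open import Data.Fin as Fin using (zero; suc)
open import Data.Fin.Subset.Properties using (_∈?_)
open import Data.Nat as ℕ using (zero; suc; _%_)
open import Data.Product using (_,_; proj₁)
open import Data.Sum using (inj₁; inj₂)
open import Data.Vec using ([]; _∷_; lookup; countᵇ)
open import Data.Vec.Properties using (lookup-zipWith; lookup⇒[]=; []=⇒lookup)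
open import Data.Vec.Membership.Propositional using (find; lose)
open import Data.Vec.Membership.Propositional.Properties using (∈-lookup)
open import Data.Vec.Relation.Unary.Any using (any?)
open import Function using (_∘_)
open import Relation.Nullary using (¬_; Dec; yes; no; does; contradiction)
open import Relation.Nullary.Decidable using (_⊎-dec_)
open import Relation.Binary.PropositionalEquality
  using (_≡_; refl; sym; trans; cong; cong₂; module ≡-Reasoning)

-- 𝔽₂ is Bool with _xor_ as addition and _∧_ as multiplication; every ∑ below is in 𝔽₂.
open CommutativeRing xor-∧-commutativeRing using (semiring; *-commutativeSemigroup; +-group)
open CommutativeSemigroupProperties *-commutativeSemigroup using (interchange; xy∙z≈xz∙y)
open GroupProperties +-group using (inverseʳ-unique)
open import Algebra.Properties.Semiring.Sum semiring
  using (sum-syntax; sum-cong-≗; sum-replicate-zero; ∑-comm; ∑-distrib-+; *-distribʳ-sum)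

open ≡-Reasoning

parity : ℕ → Bool
parity zero    = false
parity (suc k) = not (parity k)

parity-+ : ∀ m n → parity (m + n) ≡ parity m xor parity n
parity-+ zero    n = refl
parity-+ (suc m) n = trans (cong not (parity-+ m n)) (not-distribˡ-xor (parity m) (parity n))

parity-double : ∀ n → parity (n + n) ≡ false
parity-double n = trans (parity-+ n n) (xor-same (parity n))

Odd? : (k : ℕ) → Dec (Odd k)
Odd? k = k % 2 ℕ.≟ 1

Odd⇒parity≡true : ∀ k → Odd k → parity k ≡ true
Odd⇒parity≡true zero          ()
Odd⇒parity≡true (suc zero)    _   = refl
Odd⇒parity≡true (suc (suc k)) odd = trans (not-involutive (parity k)) (Odd⇒parity≡true k odd)

parity≡true⇒Odd : ∀ k → parity k ≡ true → Odd k
parity≡true⇒Odd zero          ()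
parity≡true⇒Odd (suc zero)    _ = refl
parity≡true⇒Odd (suc (suc k)) p = parity≡true⇒Odd k (trans (sym (not-involutive (parity k))) p)

¬Odd⇒parity≡false : ∀ k → ¬ Odd k → parity k ≡ false
¬Odd⇒parity≡false k notOdd = ¬-not (notOdd ∘ parity≡true⇒Odd k)

parity-countᵇ : ∀ {A : Set} {k} (p : A → Bool) (xs : Vec A k) →
                parity (countᵇ p xs) ≡ ∑[ i < k ] p (lookup xs i)
parity-countᵇ p []       = refl
parity-countᵇ p (x ∷ xs) with p x
... | true  = cong not (parity-countᵇ p xs)
... | false = parity-countᵇ p xs

parity-∣∣ : ∀ {m} (S : Subset m) → parity ∣ S ∣ ≡ ∑[ u < m ] lookup S u
parity-∣∣ []          = refl
parity-∣∣ (true ∷ S)  = cong not (parity-∣∣ S)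
parity-∣∣ (false ∷ S) = parity-∣∣ S

parity-∣∩∣ : ∀ {m} (S T : Subset m) → parity ∣ S ∩ T ∣ ≡ ∑[ u < m ] (lookup S u ∧ lookup T u)
parity-∣∩∣ S T = trans (parity-∣∣ (S ∩ T)) (sum-cong-≗ (λ u → lookup-zipWith _∧_ u S T))

∑-const : ∀ m c → ∑[ _ < m ] c ≡ parity m ∧ c
∑-const zero    c = refl
∑-const (suc m) c = trans (cong (c xor_) (∑-const m c)) (sym (∧-distribʳ-xor c true (parity m)))

∑-δ : ∀ {m} (f : Fin m → Bool) v → ∑[ u < m ] (does (u Fin.≟ v) ∧ f u) ≡ f v
∑-δ {suc m} f zero    = trans (cong (f zero xor_) (sum-replicate-zero m)) (xor-identityʳ (f zero))
∑-δ {suc m} f (suc v) = ∑-δ (f ∘ suc) v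

does-∈? : ∀ {m} (u : Fin m) (S : Subset m) → does (u ∈? S) ≡ lookup S u
does-∈? zero    (true ∷ S)  = refl
does-∈? zero    (false ∷ S) = refl
does-∈? (suc u) (_ ∷ S)     = does-∈? u S

MeetsEvenly : ∀ {m} → Subset m → Biclique m → Set
MeetsEvenly I B = parity ∣ X B ∩ I ∣ ≡ false × parity ∣ Y B ∩ I ∣ ≡ false

module _ {m : ℕ} (B : Biclique m) where

  private
    x y : Fin m → Bool
    x = lookup (X B)
    y = lookup (Y B)

  parts-disjoint : ∀ u → x u ∧ y u ≡ false
  parts-disjoint u = ¬-not λ u∈X∩Y →
    disjoint B (u , lookup⇒[]= u (X B ∩ Y B) (trans (lookup-zipWith _∧_ u (X B) (Y B)) u∈X∩Y))

  covers-as-xor : ∀ u v → covers B u v ≡ (x u ∧ y v) xor (y u ∧ x v)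
  covers-as-xor u v = begin
    covers B u v
      ≡⟨ cong₂ _∨_ (cong₂ _∧_ (does-∈? u (X B)) (does-∈? v (Y B)))
                   (trans (cong₂ _∧_ (does-∈? v (X B)) (does-∈? u (Y B))) (∧-comm (x v) (y u))) ⟩
    a ∨ b                     ≡⟨ sym (∧-identityʳ (a ∨ b)) ⟩
    (a ∨ b) ∧ not false       ≡⟨ cong (λ c → (a ∨ b) ∧ not c) (sym a∧b≡false) ⟩
    (a ∨ b) ∧ not (a ∧ b)     ≡⟨ sym (xor-is-ok a b) ⟩
    a xor b                   ∎
    where
    a b : Bool
    a = x u ∧ y v
    b = y u ∧ x v
    a∧b≡false : a ∧ b ≡ false
    a∧b≡false = trans (interchange (x u) (y v) (y u) (x v))
                      (cong (_∧ (y v ∧ x v)) (parts-disjoint u))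

  covers-diagonal : ∀ u → covers B u u ≡ false
  covers-diagonal u = trans (covers-as-xor u u)
    (cong₂ _xor_ (parts-disjoint u) (trans (∧-comm (y u) (x u)) (parts-disjoint u)))

  ∑-covers∧ : ∀ (I : Subset m) v →
    ∑[ u < m ] (covers B u v ∧ lookup I u)
      ≡ (parity ∣ X B ∩ I ∣ ∧ y v) xor (parity ∣ Y B ∩ I ∣ ∧ x v)
  ∑-covers∧ I v = begin
    ∑[ u < m ] (covers B u v ∧ lookup I u)
      ≡⟨ sum-cong-≗ expand ⟩
    ∑[ u < m ] (((x u ∧ lookup I u) ∧ y v) xor ((y u ∧ lookup I u) ∧ x v))
      ≡⟨ ∑-distrib-+ (λ u → (x u ∧ lookup I u) ∧ y v) (λ u → (y u ∧ lookup I u) ∧ x v) ⟩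
    ∑[ u < m ] ((x u ∧ lookup I u) ∧ y v) xor ∑[ u < m ] ((y u ∧ lookup I u) ∧ x v)
      ≡⟨ sym (cong₂ _xor_ (*-distribʳ-sum (y v) (λ u → x u ∧ lookup I u))
                          (*-distribʳ-sum (x v) (λ u → y u ∧ lookup I u))) ⟩
    (∑[ u < m ] (x u ∧ lookup I u) ∧ y v) xor (∑[ u < m ] (y u ∧ lookup I u) ∧ x v)
      ≡⟨ sym (cong₂ _xor_ (cong (_∧ y v) (parity-∣∩∣ (X B) I))
                          (cong (_∧ x v) (parity-∣∩∣ (Y B) I))) ⟩
    (parity ∣ X B ∩ I ∣ ∧ y v) xor (parity ∣ Y B ∩ I ∣ ∧ x v)
      ∎
    where
    expand : ∀ u → covers B u v ∧ lookup I u
                 ≡ ((x u ∧ lookup I u) ∧ y v) xor ((y u ∧ lookup I u) ∧ x v)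
    expand u = trans (cong (_∧ lookup I u) (covers-as-xor u v))
      (trans (∧-distribʳ-xor (lookup I u) (x u ∧ y v) (y u ∧ x v))
             (cong₂ _xor_ (xy∙z≈xz∙y (x u) (y v) (lookup I u))
                          (xy∙z≈xz∙y (y u) (x v) (lookup I u))))

  ∑-covers∧-evenlyMet : ∀ {I : Subset m} → MeetsEvenly I B →
    ∀ v → ∑[ u < m ] (covers B u v ∧ lookup I u) ≡ false
  ∑-covers∧-evenlyMet {I} (X∩I-even , Y∩I-even) v = trans (∑-covers∧ I v)
    (cong₂ (λ p q → (p ∧ y v) xor (q ∧ x v)) X∩I-even Y∩I-even)

module _ {m k : ℕ} (𝒪 : Collection m k) where

  parity-coverCount : ∀ u v → parity (coverCount 𝒪 u v) ≡ ∑[ i < k ] covers (lookup 𝒪 i) u v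
  parity-coverCount u v = parity-countᵇ (λ B → covers B u v) 𝒪

  ∑-parity-coverCount∧ : ∀ (I : Subset m) v →
    ∑[ u < m ] (parity (coverCount 𝒪 u v) ∧ lookup I u)
      ≡ ∑[ i < k ] ∑[ u < m ] (covers (lookup 𝒪 i) u v ∧ lookup I u)
  ∑-parity-coverCount∧ I v = begin
    ∑[ u < m ] (parity (coverCount 𝒪 u v) ∧ lookup I u)
      ≡⟨ sum-cong-≗ (λ u → cong (_∧ lookup I u) (parity-coverCount u v)) ⟩
    ∑[ u < m ] (∑[ i < k ] covers (lookup 𝒪 i) u v ∧ lookup I u)
      ≡⟨ sum-cong-≗ (λ u → *-distribʳ-sum (lookup I u) (λ i → covers (lookup 𝒪 i) u v)) ⟩
    ∑[ u < m ] ∑[ i < k ] (covers (lookup 𝒪 i) u v ∧ lookup I u)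
      ≡⟨ ∑-comm (λ u i → covers (lookup 𝒪 i) u v ∧ lookup I u) ⟩
    ∑[ i < k ] ∑[ u < m ] (covers (lookup 𝒪 i) u v ∧ lookup I u)
      ∎

  parity-coverCount-complete : IsOddCover Complete 𝒪 →
    ∀ u v → parity (coverCount 𝒪 u v) ≡ not (does (u Fin.≟ v))
  parity-coverCount-complete cover u v with u Fin.≟ v
  ... | yes refl = begin
    parity (coverCount 𝒪 u u)           ≡⟨ parity-coverCount u u ⟩
    ∑[ i < k ] covers (lookup 𝒪 i) u u  ≡⟨ sum-cong-≗ (λ i → covers-diagonal (lookup 𝒪 i) u) ⟩
    ∑[ i < k ] false                    ≡⟨ sum-replicate-zero k ⟩
    false                               ∎
  ... | no u≢v   = Odd⇒parity≡true (coverCount 𝒪 u v) (proj₁ (cover u v u≢v) u≢v)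

  evenlyMet⇒constant : IsOddCover Complete 𝒪 → (I : Subset m) →
    (∀ i → MeetsEvenly I (lookup 𝒪 i)) → ∀ v → lookup I v ≡ parity ∣ I ∣
  evenlyMet⇒constant cover I evenlyMet v =
    inverseʳ-unique (parity ∣ I ∣) (lookup I v) (trans (sym viaComplete) viaBicliques)
    where
    column : Bool
    column = ∑[ u < m ] (parity (coverCount 𝒪 u v) ∧ lookup I u)

    δ : Fin m → Bool
    δ u = does (u Fin.≟ v)

    viaBicliques : column ≡ false
    viaBicliques = begin
      column
        ≡⟨ ∑-parity-coverCount∧ I v ⟩
      ∑[ i < k ] ∑[ u < m ] (covers (lookup 𝒪 i) u v ∧ lookup I u)
        ≡⟨ sum-cong-≗ (λ i → ∑-covers∧-evenlyMet (lookup 𝒪 i) (evenlyMet i) v) ⟩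
      ∑[ i < k ] false
        ≡⟨ sum-replicate-zero k ⟩
      false
        ∎

    viaComplete : column ≡ parity ∣ I ∣ xor lookup I v
    viaComplete = begin
      column
        ≡⟨ sum-cong-≗ (λ u → cong (_∧ lookup I u) (parity-coverCount-complete cover u v)) ⟩
      ∑[ u < m ] (not (δ u) ∧ lookup I u)
        ≡⟨ sum-cong-≗ (λ u → ∧-distribʳ-xor (lookup I u) true (δ u)) ⟩
      ∑[ u < m ] (lookup I u xor (δ u ∧ lookup I u))
        ≡⟨ ∑-distrib-+ (lookup I) (λ u → δ u ∧ lookup I u) ⟩
      ∑[ u < m ] lookup I u xor ∑[ u < m ] (δ u ∧ lookup I u)
        ≡⟨ cong₂ _xor_ (sym (parity-∣∣ I)) (∑-δ (lookup I) v) ⟩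
      parity ∣ I ∣ xor lookup I v
        ∎

constant⇒empty : ∀ {m} → parity m ≡ false → (I : Subset m) →
  (∀ v → lookup I v ≡ parity ∣ I ∣) → ∀ v → lookup I v ≡ false
constant⇒empty {m} m-even I constant v = trans (constant v) ∣I∣-even
  where
  ∣I∣-even : parity ∣ I ∣ ≡ false
  ∣I∣-even = begin
    parity ∣ I ∣                 ≡⟨ parity-∣∣ I ⟩
    ∑[ u < m ] lookup I u        ≡⟨ sum-cong-≗ constant ⟩
    ∑[ _ < m ] parity ∣ I ∣      ≡⟨ ∑-const m (parity ∣ I ∣) ⟩
    parity m ∧ parity ∣ I ∣      ≡⟨ cong (_∧ parity ∣ I ∣) m-even ⟩
    false                        ∎

corollary21 : (n : ℕ) → n ≥ 1 → (𝒪 : Collection (n + n) n) → PerfectOddCoverK n 𝒪 →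
    (I : Subset (n + n)) → Nonempty I →
    Σ (Biclique (n + n)) (λ B → B ∈ 𝒪 × (Odd ∣ X B ∩ I ∣ ⊎ Odd ∣ Y B ∩ I ∣))
corollary21 n _ 𝒪 cover I (v , v∈I) with any? (λ B → Odd? ∣ X B ∩ I ∣ ⊎-dec Odd? ∣ Y B ∩ I ∣) 𝒪
... | yes oddlyMet = find oddlyMet
... | no noneOddlyMet = contradiction (trans (sym (I-empty v)) ([]=⇒lookup v∈I)) λ ()
  where
  evenlyMet : ∀ i → MeetsEvenly I (lookup 𝒪 i)
  evenlyMet i = ¬Odd⇒parity≡false (∣ X Bᵢ ∩ I ∣) (notOddlyMet ∘ inj₁)
              , ¬Odd⇒parity≡false (∣ Y Bᵢ ∩ I ∣) (notOddlyMet ∘ inj₂)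
    where
    Bᵢ : Biclique (n + n)
    Bᵢ = lookup 𝒪 i
    notOddlyMet : ¬ (Odd ∣ X Bᵢ ∩ I ∣ ⊎ Odd ∣ Y Bᵢ ∩ I ∣)
    notOddlyMet = noneOddlyMet ∘ lose (∈-lookup i 𝒪)

  I-empty : ∀ u → lookup I u ≡ false
  I-empty = constant⇒empty (parity-double n) I (evenlyMet⇒constant 𝒪 cover I evenlyMet)
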